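{- A perfect cuboid exists if and only if there exist rational numbers $\xi,\zeta\in\mathbb{Q}\setminus\{0,1,-1\}$ with $\xi\neq\zeta$ such that all three of the following are squares of rational numbers: $$\xi\zeta,\qquad (1-\xi^2)(1-\zeta^2),\qquad (1-\xi^2)(1-\zeta^2)+4\xi\zeta .$$
   Context: A perfect cuboid is a rectangular box whose three edges $a,b,c$, three face diagonals $d_{ab}=\sqrt{a^2+b^2}$, $d_{bc}=\sqrt{b^2+c^2}$, $d_{ac}=\sqrt{a^2+c^2}$ and space diagonal $d_s=\sqrt{a^2+b^2+c^2}$ are all rational (equivalently, after scaling, all integers), with $a,b,c$ nonzero. -}

module Defs where

open import Data.Rational using (ℚ; _+_; _*_; _-_; 0ℚ; 1ℚ; -_)
open import Data.Product using (Σ; _×_; ∃)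
open import Relation.Binary.PropositionalEquality using (_≡_; _≢_)

IsSquare : ℚ → Set
IsSquare q = Σ ℚ (λ r → r * r ≡ q)

IsPerfectCuboid : ℚ → ℚ → ℚ → Set
IsPerfectCuboid a b c =
  a ≢ 0ℚ × b ≢ 0ℚ × c ≢ 0ℚ ×
  IsSquare (a * a + b * b) × IsSquare (b * b + c * c) ×
  IsSquare (a * a + c * c) × IsSquare (a * a + b * b + c * c)

PerfectCuboidExists : Set
PerfectCuboidExists = Σ ℚ (λ a → Σ ℚ (λ b → Σ ℚ (λ c → IsPerfectCuboid a b c)))

NotZeroOrUnit : ℚ → Set
NotZeroOrUnit x = x ≢ 0ℚ × x ≢ 1ℚ × x ≢ - 1ℚ

CriterionHolds : Set
CriterionHolds = Σ ℚ (λ ξ → Σ ℚ (λ ζ →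
  NotZeroOrUnit ξ × NotZeroOrUnit ζ × ξ ≢ ζ ×
  IsSquare (ξ * ζ) ×
  IsSquare ((1ℚ - ξ * ξ) * (1ℚ - ζ * ζ)) ×
  IsSquare ((1ℚ - ξ * ξ) * (1ℚ - ζ * ζ) + (1ℚ + 1ℚ + 1ℚ + 1ℚ) * ξ * ζ)))

-- For rationals ξ, ζ write P = (1 − ξ²)(1 − ζ²). The identities
--   P = (1 − ξζ)² − (ξ − ζ)²,   P + 4ξζ = (1 + ξζ)² − (ξ − ζ)²,   (ξ + ζ)² = (ξ − ζ)² + 4ξζ
-- say that the box with edges ξ − ζ, √P, 2√(ξζ) has diagonals 1 − ξζ, √(P + 4ξζ), ξ + ζ
-- and 1 + ξζ; the side conditions ξ, ζ ∉ {0, ±1}, ξ ≠ ζ make exactly these edges nonzero.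
-- Conversely, a perfect cuboid with edges a, b, c, face diagonals p, q, r
-- (over ab, bc, ac) and space diagonal s has exactly this shape up to the factor 2/(s + p):
-- for ξ, ζ = (r ± a)/(s + p) one gets ξζ = c²/(s + p)² = (s − p)/(s + p), hence
-- 1 − ξζ, 1 + ξζ, ξ − ζ are 2/(s + p) times p, s, a.
module Submission where

open import Defs
open import Data.Rational
open import Data.Rational.Properties
open import Data.Product using (_,_)
open import Data.List using (_∷_; [])
open import Function.Base using (_∘_)
open import Function.Bundles using (_⇔_; mk⇔)
open import Level using (0ℓ)
open import Relation.Binary.PropositionalEquality
open import Relation.Nullary.Decidable.Core using (dec⇒maybe)
open import Tactic.RingSolver using (solve)
import Tactic.RingSolver.Core.AlmostCommutativeRing as ACR
import Algebra.Apartness.Properties.HeytingCommutativeRing as HeytingProperties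
import Algebra.Properties.Group as GroupProperties

open HeytingProperties heytingCommutativeRing using () renaming (x#0y#0→xy#0 to x*y≢0)
open GroupProperties +-0-group using () renaming (x∙y⁻¹≈ε⇒x≈y to x-y≡0⇒x≡y; x≈y⇒x∙y⁻¹≈ε to x≡y⇒x-y≡0)
open ≡-Reasoning

ℚ-ring : ACR.AlmostCommutativeRing 0ℓ 0ℓ
ℚ-ring = ACR.fromCommutativeRing +-*-commutativeRing (λ x → dec⇒maybe (0ℚ ≟ x))

x*y≢0⇒x≢0 : ∀ {x y} → x * y ≢ 0ℚ → x ≢ 0ℚ
x*y≢0⇒x≢0 {y = y} xy≢0 refl = xy≢0 (*-zeroˡ y)

x*y≡1⇒x≢0 : ∀ {x y} → x * y ≡ 1ℚ → x ≢ 0ℚ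
x*y≡1⇒x≢0 {y = y} xy≡1 refl = 1≢0 (trans (sym xy≡1) (*-zeroˡ y))

x*x≡y⇒x≢0 : ∀ {x y} → x * x ≡ y → y ≢ 0ℚ → x ≢ 0ℚ
x*x≡y⇒x≢0 x²≡y y≢0 refl = y≢0 (sym x²≡y)

x*x≡y⇒y≢0 : ∀ {x y} → x * x ≡ y → x ≢ 0ℚ → y ≢ 0ℚ
x*x≡y⇒y≢0 x²≡y x≢0 = subst (_≢ 0ℚ) x²≡y (x*y≢0 x≢0 x≢0)

1-x²≢0 : ∀ {x} → x ≢ 1ℚ → x ≢ - 1ℚ → 1ℚ - x * x ≢ 0ℚ
1-x²≢0 {x} x≢1 x≢-1 = subst (_≢ 0ℚ) factorisation
  (x*y≢0 (x≢1 ∘ sym ∘ x-y≡0⇒x≡y 1ℚ x) (x≢-1 ∘ x-y≡0⇒x≡y x (- 1ℚ)))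
  where
  -- the second factor is written x - (- 1) so that x-y≡0⇒x≡y applies to it
  factorisation : (1ℚ - x) * (x - (- 1ℚ)) ≡ 1ℚ - x * x
  factorisation = solve (x ∷ []) ℚ-ring

notZeroOrUnitˡ : ∀ {x y} → x * y ≢ 0ℚ → (1ℚ - x * x) * (1ℚ - y * y) ≢ 0ℚ →
                 NotZeroOrUnit x
notZeroOrUnitˡ {y = y} xy≢0 P≢0 =
    x*y≢0⇒x≢0 xy≢0
  , (λ { refl → P≢0 (*-zeroˡ (1ℚ - y * y)) })
  , (λ { refl → P≢0 (*-zeroˡ (1ℚ - y * y)) })

notZeroOrUnitʳ : ∀ {x y} → x * y ≢ 0ℚ → (1ℚ - x * x) * (1ℚ - y * y) ≢ 0ℚ →
                 NotZeroOrUnit y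
notZeroOrUnitʳ {x} {y} xy≢0 P≢0 = notZeroOrUnitˡ
  (xy≢0 ∘ trans (*-comm x y)) (P≢0 ∘ trans (*-comm (1ℚ - x * x) (1ℚ - y * y)))

[1-x²][1-y²]≡[1-xy]²-[x-y]² : ∀ x y →
  (1ℚ - x * x) * (1ℚ - y * y) ≡ (1ℚ - x * y) * (1ℚ - x * y) - (x - y) * (x - y)
[1-x²][1-y²]≡[1-xy]²-[x-y]² x y = solve (x ∷ y ∷ []) ℚ-ring

[1-x²][1-y²]+4xy≡[1+xy]²-[x-y]² : ∀ x y →
  (1ℚ - x * x) * (1ℚ - y * y) + (1ℚ + 1ℚ + 1ℚ + 1ℚ) * x * y
    ≡ (1ℚ + x * y) * (1ℚ + x * y) - (x - y) * (x - y)
[1-x²][1-y²]+4xy≡[1+xy]²-[x-y]² x y = solve (x ∷ y ∷ []) ℚ-ring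

[1-xy]²≡[x-y]²+[1-x²][1-y²] : ∀ x y →
  (1ℚ - x * y) * (1ℚ - x * y) ≡ (x - y) * (x - y) + (1ℚ - x * x) * (1ℚ - y * y)
[1-xy]²≡[x-y]²+[1-x²][1-y²] x y = solve (x ∷ y ∷ []) ℚ-ring

[1+xy]²≡[x-y]²+[1-x²][1-y²]+4xy : ∀ x y →
  (1ℚ + x * y) * (1ℚ + x * y)
    ≡ (x - y) * (x - y) + (1ℚ - x * x) * (1ℚ - y * y) + (1ℚ + 1ℚ + 1ℚ + 1ℚ) * x * y
[1+xy]²≡[x-y]²+[1-x²][1-y²]+4xy x y = solve (x ∷ y ∷ []) ℚ-ring

[x+y]²≡[x-y]²+4xy : ∀ x y → (x + y) * (x + y) ≡ (x - y) * (x - y) + (1ℚ + 1ℚ + 1ℚ + 1ℚ) * x * y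
[x+y]²≡[x-y]²+4xy x y = solve (x ∷ y ∷ []) ℚ-ring

z²≡x²+y²⇒y²≡[z+x][z-x] : ∀ {x y z} → z * z ≡ x * x + y * y → y * y ≡ (z + x) * (z - x)
z²≡x²+y²⇒y²≡[z+x][z-x] {x} {y} {z} z²≡x²+y² = begin
  y * y                   ≡⟨ solve (x ∷ y ∷ []) ℚ-ring ⟩
  (x * x + y * y) - x * x ≡⟨ cong (_- x * x) z²≡x²+y² ⟨
  z * z - x * x           ≡⟨ solve (x ∷ z ∷ []) ℚ-ring ⟩
  (z + x) * (z - x)       ∎

z²≡x²+y²⇒[mz]²-[mx]²≡[my]² : ∀ {x y z} m → z * z ≡ x * x + y * y →
  (m * z) * (m * z) - (m * x) * (m * x) ≡ (m * y) * (m * y)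
z²≡x²+y²⇒[mz]²-[mx]²≡[my]² {x} {y} {z} m z²≡x²+y² = begin
  (m * z) * (m * z) - (m * x) * (m * x) ≡⟨ solve (m ∷ x ∷ z ∷ []) ℚ-ring ⟩
  (m * m) * (z * z - x * x)             ≡⟨ cong (λ t → (m * m) * (t - x * x)) z²≡x²+y² ⟩
  (m * m) * ((x * x + y * y) - x * x)   ≡⟨ solve (m ∷ x ∷ y ∷ []) ℚ-ring ⟩
  (m * y) * (m * y)                     ∎

criterion⇒cuboid : CriterionHolds → PerfectCuboidExists
criterion⇒cuboid (ξ , ζ , (ξ≢0 , ξ≢1 , ξ≢-1) , (ζ≢0 , ζ≢1 , ζ≢-1) , ξ≢ζ
                 , (t , t²≡ξζ) , (b , b²≡P) , (q , q²≡P+4ξζ)) =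
  ξ - ζ , b , c , ξ≢ζ ∘ x-y≡0⇒x≡y ξ ζ , b≢0 , c≢0
  , (1ℚ - ξ * ζ , face-ab) , (q , face-bc) , (ξ + ζ , face-ac) , (1ℚ + ξ * ζ , space)
  where
  a c : ℚ
  a = ξ - ζ
  c = (1ℚ + 1ℚ) * t

  b≢0 : b ≢ 0ℚ
  b≢0 = x*x≡y⇒x≢0 b²≡P (x*y≢0 (1-x²≢0 ξ≢1 ξ≢-1) (1-x²≢0 ζ≢1 ζ≢-1))

  c≢0 : c ≢ 0ℚ
  c≢0 = x*y≢0 {1ℚ + 1ℚ} {t} (λ ()) (x*x≡y⇒x≢0 t²≡ξζ (x*y≢0 ξ≢0 ζ≢0))

  c²≡4ξζ : c * c ≡ (1ℚ + 1ℚ + 1ℚ + 1ℚ) * ξ * ζ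
  c²≡4ξζ = begin
    ((1ℚ + 1ℚ) * t) * ((1ℚ + 1ℚ) * t) ≡⟨ solve (t ∷ []) ℚ-ring ⟩
    (1ℚ + 1ℚ + 1ℚ + 1ℚ) * (t * t)     ≡⟨ cong ((1ℚ + 1ℚ + 1ℚ + 1ℚ) *_) t²≡ξζ ⟩
    (1ℚ + 1ℚ + 1ℚ + 1ℚ) * (ξ * ζ)     ≡⟨ *-assoc (1ℚ + 1ℚ + 1ℚ + 1ℚ) ξ ζ ⟨
    (1ℚ + 1ℚ + 1ℚ + 1ℚ) * ξ * ζ       ∎

  face-ab : (1ℚ - ξ * ζ) * (1ℚ - ξ * ζ) ≡ a * a + b * b
  face-ab = trans ([1-xy]²≡[x-y]²+[1-x²][1-y²] ξ ζ) (cong (a * a +_) (sym b²≡P))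

  face-bc : q * q ≡ b * b + c * c
  face-bc = trans q²≡P+4ξζ (sym (cong₂ _+_ b²≡P c²≡4ξζ))

  face-ac : (ξ + ζ) * (ξ + ζ) ≡ a * a + c * c
  face-ac = trans ([x+y]²≡[x-y]²+4xy ξ ζ) (cong (a * a +_) (sym c²≡4ξζ))

  space : (1ℚ + ξ * ζ) * (1ℚ + ξ * ζ) ≡ a * a + b * b + c * c
  space = trans ([1+xy]²≡[x-y]²+[1-x²][1-y²]+4xy ξ ζ)
                (sym (cong₂ (λ u v → a * a + u + v) b²≡P c²≡4ξζ))

module CuboidParameters
  (a b c p q r s k : ℚ)
  (p²≡a²+b² : p * p ≡ a * a + b * b) (r²≡a²+c² : r * r ≡ a * a + c * c)
  (s²≡p²+c² : s * s ≡ p * p + c * c) (s²≡a²+q² : s * s ≡ a * a + q * q)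
  (k[s+p]≡1 : k * (s + p) ≡ 1ℚ)
  where

  ξ ζ m : ℚ
  ξ = (r + a) * k
  ζ = (r - a) * k
  m = (1ℚ + 1ℚ) * k

  ξζ≡[ck]² : ξ * ζ ≡ (c * k) * (c * k)
  ξζ≡[ck]² = begin
    ((r + a) * k) * ((r - a) * k) ≡⟨ solve (r ∷ a ∷ k ∷ []) ℚ-ring ⟩
    ((r + a) * (r - a)) * (k * k) ≡⟨ cong (_* (k * k)) (z²≡x²+y²⇒y²≡[z+x][z-x] {a} {c} {r} r²≡a²+c²) ⟨
    (c * c) * (k * k)             ≡⟨ solve (c ∷ k ∷ []) ℚ-ring ⟩
    (c * k) * (c * k)             ∎

  ξζ≡[s-p]k : ξ * ζ ≡ (s - p) * k
  ξζ≡[s-p]k = begin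
    ξ * ζ                         ≡⟨ ξζ≡[ck]² ⟩
    (c * k) * (c * k)             ≡⟨ solve (c ∷ k ∷ []) ℚ-ring ⟩
    (c * c) * (k * k)             ≡⟨ cong (_* (k * k)) (z²≡x²+y²⇒y²≡[z+x][z-x] {p} {c} {s} s²≡p²+c²) ⟩
    ((s + p) * (s - p)) * (k * k) ≡⟨ solve (s ∷ p ∷ k ∷ []) ℚ-ring ⟩
    (s - p) * k * (k * (s + p))   ≡⟨ cong ((s - p) * k *_) k[s+p]≡1 ⟩
    (s - p) * k * 1ℚ              ≡⟨ *-identityʳ ((s - p) * k) ⟩
    (s - p) * k                   ∎

  1-ξζ≡mp : 1ℚ - ξ * ζ ≡ m * p
  1-ξζ≡mp = begin
    1ℚ - ξ * ζ                ≡⟨ cong₂ _-_ (sym k[s+p]≡1) ξζ≡[s-p]k ⟩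
    k * (s + p) - (s - p) * k ≡⟨ solve (s ∷ p ∷ k ∷ []) ℚ-ring ⟩
    (1ℚ + 1ℚ) * k * p         ∎

  1+ξζ≡ms : 1ℚ + ξ * ζ ≡ m * s
  1+ξζ≡ms = begin
    1ℚ + ξ * ζ                ≡⟨ cong₂ _+_ (sym k[s+p]≡1) ξζ≡[s-p]k ⟩
    k * (s + p) + (s - p) * k ≡⟨ solve (s ∷ p ∷ k ∷ []) ℚ-ring ⟩
    (1ℚ + 1ℚ) * k * s         ∎

  ξ-ζ≡ma : ξ - ζ ≡ m * a
  ξ-ζ≡ma = begin
    (r + a) * k - (r - a) * k ≡⟨ solve (r ∷ a ∷ k ∷ []) ℚ-ring ⟩
    (1ℚ + 1ℚ) * k * a         ∎

  [1-ξ²][1-ζ²]≡[mb]² : (1ℚ - ξ * ξ) * (1ℚ - ζ * ζ) ≡ (m * b) * (m * b)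
  [1-ξ²][1-ζ²]≡[mb]² = begin
    (1ℚ - ξ * ξ) * (1ℚ - ζ * ζ)                         ≡⟨ [1-x²][1-y²]≡[1-xy]²-[x-y]² ξ ζ ⟩
    (1ℚ - ξ * ζ) * (1ℚ - ξ * ζ) - (ξ - ζ) * (ξ - ζ)     ≡⟨ cong₂ (λ u v → u * u - v * v) 1-ξζ≡mp ξ-ζ≡ma ⟩
    (m * p) * (m * p) - (m * a) * (m * a)               ≡⟨ z²≡x²+y²⇒[mz]²-[mx]²≡[my]² m p²≡a²+b² ⟩
    (m * b) * (m * b)                                   ∎

  [1-ξ²][1-ζ²]+4ξζ≡[mq]² :
    (1ℚ - ξ * ξ) * (1ℚ - ζ * ζ) + (1ℚ + 1ℚ + 1ℚ + 1ℚ) * ξ * ζ ≡ (m * q) * (m * q)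
  [1-ξ²][1-ζ²]+4ξζ≡[mq]² = begin
    (1ℚ - ξ * ξ) * (1ℚ - ζ * ζ) + (1ℚ + 1ℚ + 1ℚ + 1ℚ) * ξ * ζ
      ≡⟨ [1-x²][1-y²]+4xy≡[1+xy]²-[x-y]² ξ ζ ⟩
    (1ℚ + ξ * ζ) * (1ℚ + ξ * ζ) - (ξ - ζ) * (ξ - ζ)
      ≡⟨ cong₂ (λ u v → u * u - v * v) 1+ξζ≡ms ξ-ζ≡ma ⟩
    (m * s) * (m * s) - (m * a) * (m * a)
      ≡⟨ z²≡x²+y²⇒[mz]²-[mx]²≡[my]² m s²≡a²+q² ⟩
    (m * q) * (m * q)
      ∎

cuboid⇒criterion : PerfectCuboidExists → CriterionHolds
cuboid⇒criterion (a , b , c , a≢0 , b≢0 , c≢0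
                 , (p , p²≡a²+b²) , (q , q²≡b²+c²) , (r , r²≡a²+c²) , (s , s²≡a²+b²+c²)) =
  ξ , ζ , notZeroOrUnitˡ {ξ} {ζ} ξζ≢0 P≢0 , notZeroOrUnitʳ {ξ} {ζ} ξζ≢0 P≢0 , ξ≢ζ
  , (c * k , sym ξζ≡[ck]²) , (m * b , sym [1-ξ²][1-ζ²]≡[mb]²) , (m * q , sym [1-ξ²][1-ζ²]+4ξζ≡[mq]²)
  where
  s²≡p²+c² : s * s ≡ p * p + c * c
  s²≡p²+c² = trans s²≡a²+b²+c² (cong (_+ c * c) (sym p²≡a²+b²))

  s²≡a²+q² : s * s ≡ a * a + q * q
  s²≡a²+q² = trans s²≡a²+b²+c²
    (trans (+-assoc (a * a) (b * b) (c * c)) (cong (a * a +_) (sym q²≡b²+c²)))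

  s+p≢0 : s + p ≢ 0ℚ
  s+p≢0 = x*y≢0⇒x≢0 (x*x≡y⇒y≢0 (z²≡x²+y²⇒y²≡[z+x][z-x] {p} {c} {s} s²≡p²+c²) c≢0)

  instance
    s+p-nonZero : NonZero (s + p)
    s+p-nonZero = ≢-nonZero s+p≢0

  k : ℚ
  k = 1/ (s + p)

  open CuboidParameters a b c p q r s k p²≡a²+b² r²≡a²+c² s²≡p²+c² s²≡a²+q² (*-inverseˡ (s + p))

  k≢0 : k ≢ 0ℚ
  k≢0 = x*y≡1⇒x≢0 (*-inverseˡ (s + p))

  m≢0 : m ≢ 0ℚ
  m≢0 = x*y≢0 {1ℚ + 1ℚ} {k} (λ ()) k≢0

  ξζ≢0 : ξ * ζ ≢ 0ℚ
  ξζ≢0 = x*x≡y⇒y≢0 (sym ξζ≡[ck]²) (x*y≢0 {c} {k} c≢0 k≢0)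

  P≢0 : (1ℚ - ξ * ξ) * (1ℚ - ζ * ζ) ≢ 0ℚ
  P≢0 = x*x≡y⇒y≢0 (sym [1-ξ²][1-ζ²]≡[mb]²) (x*y≢0 {m} {b} m≢0 b≢0)

  ξ≢ζ : ξ ≢ ζ
  ξ≢ζ ξ≡ζ = x*y≢0 {m} {a} m≢0 a≢0 (trans (sym ξ-ζ≡ma) (x≡y⇒x-y≡0 ξ≡ζ))

theorem1 : PerfectCuboidExists ⇔ CriterionHolds
theorem1 = mk⇔ cuboid⇒criterion criterion⇒cuboid
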